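{- For $n\in\{2,3,4\}$, every projective plane of order $n$ is magic over the group $G=(\mathbb{Z}/n\mathbb{Z})^3$.
   Context: A projective plane $\Pi=(\mathcal{P},\mathcal{L})$ consists of points $\mathcal{P}$ and lines $\mathcal{L}$ (subsets of $\mathcal{P}$) such that any two distinct points lie on a unique common line, any two distinct lines meet in a unique point, and there exist four points no three collinear. A finite projective plane has an order $n$: every line has $n+1$ points, every point is on $n+1$ lines, and $|\mathcal{P}|=|\mathcal{L}|=n^2+n+1$. For an Abelian group $G$, a function $v:\mathcal{P}\to G$ is magic if it is injective and $\sum_{x\in L}v(x)$ is the same for all $L\in\mathcal{L}$. $\Pi$ is magic over $G$ if such a $v$ exists. -}

module Defs where

open import Data.Nat using (ℕ; zero; suc; NonZero) renaming (_+_ to _+ℕ_)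
open import Data.Nat.DivMod using (_mod_)
open import Data.Fin using (Fin; toℕ)
open import Data.Bool using (Bool; true; false; if_then_else_)
open import Data.Product using (Σ; _×_; _,_; ∃; ∃-syntax)
open import Relation.Binary.PropositionalEquality using (_≡_; _≢_)
open import Relation.Nullary using (¬_)
open import Function.Definitions using (Injective)

record ProjectivePlane (p l : ℕ) : Set where
  field
    inc : Fin p → Fin l → Bool
    join     : ∀ x y → x ≢ y → ∃[ L ] (inc x L ≡ true × inc y L ≡ true)
    join-uniq : ∀ x y → x ≢ y → ∀ L M →
                inc x L ≡ true → inc y L ≡ true →
                inc x M ≡ true → inc y M ≡ true → L ≡ M
    meet     : ∀ L M → L ≢ M → ∃[ x ] (inc x L ≡ true × inc x M ≡ true)
    meet-uniq : ∀ L M → L ≢ M → ∀ x y →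
                inc x L ≡ true → inc x M ≡ true →
                inc y L ≡ true → inc y M ≡ true → x ≡ y
    quadrangle : Σ (Fin p) λ a → Σ (Fin p) λ b → Σ (Fin p) λ c → Σ (Fin p) λ d →
      (a ≢ b × a ≢ c × a ≢ d × b ≢ c × b ≢ d × c ≢ d) ×
      (∀ L → ¬ (inc a L ≡ true × inc b L ≡ true × inc c L ≡ true)) ×
      (∀ L → ¬ (inc a L ≡ true × inc b L ≡ true × inc d L ≡ true)) ×
      (∀ L → ¬ (inc a L ≡ true × inc c L ≡ true × inc d L ≡ true)) ×
      (∀ L → ¬ (inc b L ≡ true × inc c L ≡ true × inc d L ≡ true))

sumFin : ∀ {A : Set} → (A → A → A) → A → (k : ℕ) → (Fin k → A) → A
sumFin _⊕_ e zero    f = e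
sumFin _⊕_ e (suc k) f = f Fin.zero ⊕ sumFin _⊕_ e k (λ i → f (Fin.suc i))

pointsOn : ∀ {p l} → ProjectivePlane p l → Fin l → ℕ
pointsOn {p} Π L = sumFin _+ℕ_ 0 p (λ x → if ProjectivePlane.inc Π x L then 1 else 0)

HasOrder : ∀ {p l} → ProjectivePlane p l → ℕ → Set
HasOrder {l = l} Π n = ∀ (L : Fin l) → pointsOn Π L ≡ suc n

Zn³ : ℕ → Set
Zn³ n = Fin n × Fin n × Fin n

module _ (n : ℕ) .{{_ : NonZero n}} where

  _+ₙ_ : Fin n → Fin n → Fin n
  a +ₙ b = (toℕ a +ℕ toℕ b) mod n

  _+G_ : Zn³ n → Zn³ n → Zn³ n
  (a₁ , a₂ , a₃) +G (b₁ , b₂ , b₃) = (a₁ +ₙ b₁ , a₂ +ₙ b₂ , a₃ +ₙ b₃)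

  0G : Zn³ n
  0G = (0 mod n , 0 mod n , 0 mod n)

  lineSum : ∀ {p l} → ProjectivePlane p l → (Fin p → Zn³ n) → Fin l → Zn³ n
  lineSum {p} Π v L =
    sumFin _+G_ 0G p (λ x → if ProjectivePlane.inc Π x L then v x else 0G)

  IsMagic : ∀ {p l} → ProjectivePlane p l → (Fin p → Zn³ n) → Set
  IsMagic {l = l} Π v = Injective _≡_ _≡_ v × ∃[ c ] (∀ (L : Fin l) → lineSum Π v L ≡ c)

  MagicOverZn³ : ∀ {p l} → ProjectivePlane p l → Set
  MagicOverZn³ {p} Π = ∃[ v ] IsMagic Π v

module Submission where

-- A weighting a of the lines induces the point labelling x ↦ ∑_{M ∋ x} a(M);
-- its sum over a line L is ∑ a + n·a(L) ≡ ∑ a (mod n), so three weightings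
-- always give a labelling in (ℤ/nℤ)³ with constant line sums, and only
-- injectivity is at stake.  Fix a triangle ABC, number the n - 1 points of
-- BC other than B, C by 1, …, n - 1, and weight each line through A by the
-- number of its point on BC (the cone from A): the induced label of x ≠ A is
-- the number of the point where xA meets BC.  The three cones of the
-- triangle plus fixed side weights give each point a profile (its incidences
-- with the sides and its three labels) which determines it, and for n ≤ 4 a
-- finite computation shows the encoding of profiles into (ℤ/nℤ)³ injective.

open import Defs
open import Data.Bool using (Bool; true; false; if_then_else_; _∧_; not)
open import Data.Bool.Properties using (¬-not; ∧-zeroʳ) renaming (_≟_ to _≟𝔹_)
open import Data.Empty using (⊥-elim)
open import Data.Fin using (Fin; zero; suc; toℕ)
open import Data.Fin.Properties using (_≟_; suc-injective; toℕ-injective; toℕ-fromℕ<)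
open import Data.List using (List; _∷_; _++_; map; applyUpTo; cartesianProduct)
open import Data.List.Membership.Propositional using (_∈_)
open import Data.List.Membership.Propositional.Properties
  using (∈-map⁺; ∈-++⁺ˡ; ∈-++⁺ʳ; ∈-applyUpTo⁺; ∈-cartesianProduct⁺)
open import Data.List.Relation.Unary.All using (All; all?; lookup)
open import Data.List.Relation.Unary.Any using (here; there)
open import Data.Nat using (ℕ; pred; _+_; _*_; _<_; _%_; NonZero; s≤s; z≤n)
open import Data.Nat.DivMod using (_mod_; m%n<n; %-distribˡ-+; [m+kn]%n≡m%n)
open import Data.Nat.Properties
  using (+-*-semiring; +-identityʳ; *-identityˡ; *-zeroʳ; *-comm; *-distribˡ-+; *-suc; +-comm;
         +-cancelˡ-≡; +-monoʳ-<; 1+n≢0; 0≢1+n)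
  renaming (suc-injective to ℕ-suc-injective; _≟_ to _≟ℕ_)
open import Algebra.Properties.Semiring.Sum +-*-semiring
  using (sum; sum-syntax; ∑-distrib-+; ∑-comm; *-distribˡ-sum; sum-cong-≗; sum-replicate-zero)
open import Data.Nat.Tactic.RingSolver using (solve-∀)
open import Data.Product using (_×_; _,_; proj₁; proj₂)
open import Data.Product.Properties using (≡-dec)
open import Data.Sum using (_⊎_; inj₁; inj₂)
open import Function using (_∘_)
open import Function.Definitions using (Injective)
open import Relation.Binary.Definitions using (DecidableEquality)
open import Relation.Binary.PropositionalEquality
  using (_≡_; _≢_; refl; sym; trans; cong; cong₂; subst; module ≡-Reasoning)
open import Relation.Nullary.Decidable using (Dec; ⌊_⌋; yes; no; _→-dec_; toWitness)

𝟙 : Bool → ℕ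
𝟙 b = if b then 1 else 0

𝟙-square : ∀ b → 𝟙 b * 𝟙 b ≡ 𝟙 b
𝟙-square true  = refl
𝟙-square false = refl

𝟙-idem : ∀ b k → 𝟙 b * (𝟙 b * k) ≡ 𝟙 b * k
𝟙-idem true  k = cong (_+ 0) (+-identityʳ k)
𝟙-idem false k = refl

𝟙-split : ∀ a b c → (a ≡ true → b ≡ true → c ≡ false) →
          𝟙 c ≡ 𝟙 (c ∧ not a ∧ not b) + (𝟙 c * 𝟙 a + 𝟙 c * 𝟙 b)
𝟙-split a     b     false _ = refl
𝟙-split false false true  _ = refl
𝟙-split false true  true  _ = refl
𝟙-split true  false true  _ = refl
𝟙-split true  true  true  never with never refl refl
... | ()

sumFin≡∑ : ∀ k (f : Fin k → ℕ) → sumFin _+_ 0 k f ≡ ∑[ i < k ] f i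
sumFin≡∑ ℕ.zero    f = refl
sumFin≡∑ (ℕ.suc k) f = cong (f zero +_) (sumFin≡∑ k (f ∘ suc))

sumFin-cong : ∀ {A : Set} (_⊕_ : A → A → A) e k {f g : Fin k → A} →
              (∀ i → f i ≡ g i) → sumFin _⊕_ e k f ≡ sumFin _⊕_ e k g
sumFin-cong _⊕_ e ℕ.zero    f≡g = refl
sumFin-cong _⊕_ e (ℕ.suc k) f≡g = cong₂ _⊕_ (f≡g zero) (sumFin-cong _⊕_ e k (f≡g ∘ suc))

∑-zero : ∀ {k} {f : Fin k → ℕ} → (∀ i → f i ≡ 0) → ∑[ i < k ] f i ≡ 0
∑-zero {k} f≡0 = trans (sum-cong-≗ f≡0) (sum-replicate-zero k)

∑-single : ∀ {k} (f : Fin k → ℕ) i₀ → (∀ i → i ≢ i₀ → f i ≡ 0) → ∑[ i < k ] f i ≡ f i₀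
∑-single f zero f≡0 =
  trans (cong (f zero +_) (∑-zero λ i → f≡0 (suc i) λ ())) (+-identityʳ _)
∑-single f (suc i₀) f≡0 =
  trans (cong (_+ sum (f ∘ suc)) (f≡0 zero λ ()))
        (∑-single (f ∘ suc) i₀ λ i i≢i₀ → f≡0 (suc i) (i≢i₀ ∘ suc-injective))

∑-δ : ∀ {k} (f : Fin k → ℕ) i₀ → ∑[ i < k ] (𝟙 ⌊ i ≟ i₀ ⌋ * f i) ≡ f i₀
∑-δ f i₀ = trans (∑-single _ i₀ off) (on i₀)
  where
  off : ∀ i → i ≢ i₀ → 𝟙 ⌊ i ≟ i₀ ⌋ * f i ≡ 0
  off i i≢i₀ with i ≟ i₀
  ... | yes i≡i₀ = ⊥-elim (i≢i₀ i≡i₀)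
  ... | no _     = refl
  on : ∀ i → 𝟙 ⌊ i ≟ i ⌋ * f i ≡ f i
  on i with i ≟ i
  ... | yes _  = +-identityʳ (f i)
  ... | no i≢i = ⊥-elim (i≢i refl)

module Residues (n : ℕ) .{{_ : NonZero n}} where

  toℕ-mod : ∀ a → toℕ (a mod n) ≡ a % n
  toℕ-mod a = toℕ-fromℕ< (m%n<n a n)


  mod-≡ : ∀ a b → a % n ≡ b % n → a mod n ≡ b mod n
  mod-≡ a b a%n≡b%n = toℕ-injective (trans (toℕ-mod a) (trans a%n≡b%n (sym (toℕ-mod b))))

  +ₙ-mod : ∀ a b → _+ₙ_ n (a mod n) (b mod n) ≡ (a + b) mod n
  +ₙ-mod a b = mod-≡ _ _ (trans (cong₂ (λ u v → (u + v) % n) (toℕ-mod a) (toℕ-mod b))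
                            (sym (%-distribˡ-+ a b n)))

  mod-absorb : ∀ a k → (a + n * k) mod n ≡ a mod n
  mod-absorb a k = mod-≡ _ _ (trans (cong (λ z → (a + z) % n) (*-comm n k)) ([m+kn]%n≡m%n a k n))

  reduce : ℕ → ℕ → ℕ → Zn³ n
  reduce a b c = (a mod n , b mod n , c mod n)

  reduce-cong : ∀ {a b c a′ b′ c′} → a ≡ a′ → b ≡ b′ → c ≡ c′ → reduce a b c ≡ reduce a′ b′ c′
  reduce-cong refl refl refl = refl

  reduce-+ : ∀ a b c a′ b′ c′ →
             _+G_ n (reduce a b c) (reduce a′ b′ c′) ≡ reduce (a + a′) (b + b′) (c + c′)
  reduce-+ a b c a′ b′ c′ = cong₂ _,_ (+ₙ-mod a a′) (cong₂ _,_ (+ₙ-mod b b′) (+ₙ-mod c c′))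

  sumG-reduce : ∀ k (f g h : Fin k → ℕ) →
    sumFin (_+G_ n) (0G n) k (λ i → reduce (f i) (g i) (h i)) ≡ reduce (sum f) (sum g) (sum h)
  sumG-reduce ℕ.zero    f g h = refl
  sumG-reduce (ℕ.suc k) f g h =
    trans (cong (_+G_ n (reduce (f zero) (g zero) (h zero)))
                (sumG-reduce k (f ∘ suc) (g ∘ suc) (h ∘ suc)))
          (reduce-+ (f zero) (g zero) (h zero) _ _ _)

  lineSum-reduce : ∀ {p l} (Π : ProjectivePlane p l) (f g h : Fin p → ℕ) L →
    let open ProjectivePlane Π in
    lineSum n Π (λ x → reduce (f x) (g x) (h x)) L ≡
    reduce (∑[ x < p ] (𝟙 (inc x L) * f x)) (∑[ x < p ] (𝟙 (inc x L) * g x))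
           (∑[ x < p ] (𝟙 (inc x L) * h x))
  lineSum-reduce {p} Π f g h L = trans (sumFin-cong _ _ p restrict) (sumG-reduce p _ _ _)
    where
    open ProjectivePlane Π
    restrict : ∀ x → (if inc x L then reduce (f x) (g x) (h x) else 0G n) ≡
                     reduce (𝟙 (inc x L) * f x) (𝟙 (inc x L) * g x) (𝟙 (inc x L) * h x)
    restrict x with inc x L
    ... | true  = sym (reduce-cong (*-identityˡ (f x)) (*-identityˡ (g x)) (*-identityˡ (h x)))
    ... | false = refl

module Incidence {p l : ℕ} (Π : ProjectivePlane p l) where
  open ProjectivePlane Π

  infix 4 _on_ _off_
  _on_ _off_ : Fin p → Fin l → Set
  x on L  = inc x L ≡ true
  x off L = inc x L ≡ false

  off⇒≢ : ∀ {x y L} → x off L → y on L → x ≢ y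
  off⇒≢ x-off y-on refl with trans (sym x-off) y-on
  ... | ()

  on-off⇒≢ : ∀ {x L M} → x on L → x off M → L ≢ M
  on-off⇒≢ x-on x-off refl = off⇒≢ x-off x-on refl

  line : (x y : Fin p) → x ≢ y → Fin l
  line x y x≢y = proj₁ (join x y x≢y)

  on-line₁ : ∀ {x y} (x≢y : x ≢ y) → x on line x y x≢y
  on-line₁ {x} {y} x≢y = proj₁ (proj₂ (join x y x≢y))

  on-line₂ : ∀ {x y} (x≢y : x ≢ y) → y on line x y x≢y
  on-line₂ {x} {y} x≢y = proj₂ (proj₂ (join x y x≢y))

  same-line : ∀ {x y L M} → x ≢ y → x on L → y on L → x on M → y on M → L ≡ M
  same-line x≢y = join-uniq _ _ x≢y _ _

  line-unique : ∀ {x y L} (x≢y : x ≢ y) → x on L → y on L → line x y x≢y ≡ L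
  line-unique x≢y = same-line x≢y (on-line₁ x≢y) (on-line₂ x≢y)

  point : (L M : Fin l) → L ≢ M → Fin p
  point L M L≢M = proj₁ (meet L M L≢M)

  on-point₁ : ∀ {L M} (L≢M : L ≢ M) → point L M L≢M on L
  on-point₁ {L} {M} L≢M = proj₁ (proj₂ (meet L M L≢M))

  on-point₂ : ∀ {L M} (L≢M : L ≢ M) → point L M L≢M on M
  on-point₂ {L} {M} L≢M = proj₂ (proj₂ (meet L M L≢M))

  same-point : ∀ {L M x y} → L ≢ M → x on L → x on M → y on L → y on M → x ≡ y
  same-point L≢M = meet-uniq _ _ L≢M _ _

  lines-≢ : ∀ {x u w L} (x≢u : x ≢ u) (x≢w : x ≢ w) → u ≢ w → u on L → w on L → x off L →
            line x u x≢u ≢ line x w x≢w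
  lines-≢ {x} {u} {w} x≢u x≢w u≢w u-on w-on x-off xu≡xw =
    off⇒≢ x-off (subst (x on_) xu≡L (on-line₁ x≢u)) refl
    where
    xu≡L = same-line u≢w (on-line₂ x≢u) (subst (w on_) (sym xu≡xw) (on-line₂ x≢w)) u-on w-on

  through-axis : ∀ {x y A M} (x≢A : x ≢ A) → y ≢ A → y on line x A x≢A → y on M → A on M → x on M
  through-axis {x} x≢A y≢A y-axis y-M A-M =
    subst (x on_) (same-line y≢A y-axis (on-line₂ x≢A) y-M A-M) (on-line₁ x≢A)

  ∑-through : ∀ {x y} (x≢y : x ≢ y) (f : Fin l → ℕ) →
              ∑[ M < l ] (𝟙 (inc x M) * (𝟙 (inc y M) * f M)) ≡ f (line x y x≢y)
  ∑-through {x} {y} x≢y f = trans (∑-single _ (line x y x≢y) off) on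
    where
    off : ∀ M → M ≢ line x y x≢y → 𝟙 (inc x M) * (𝟙 (inc y M) * f M) ≡ 0
    off M M≢xy with inc x M in x-on | inc y M in y-on
    ... | true  | true  = ⊥-elim (M≢xy (sym (line-unique x≢y x-on y-on)))
    ... | true  | false = refl
    ... | false | _     = refl
    on : 𝟙 (inc x (line x y x≢y)) * (𝟙 (inc y (line x y x≢y)) * f (line x y x≢y)) ≡ f (line x y x≢y)
    on rewrite on-line₁ x≢y | on-line₂ x≢y = trans (*-identityˡ _) (*-identityˡ _)

  ∑-supported : ∀ {L M} (M≢L : M ≢ L) (h : Fin p → ℕ) → (∀ y → y off L → h y ≡ 0) →
                ∑[ y < p ] (𝟙 (inc y M) * h y) ≡ h (point M L M≢L)
  ∑-supported {L} {M} M≢L h h-supp = trans (∑-single _ (point M L M≢L) off) on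
    where
    off : ∀ y → y ≢ point M L M≢L → 𝟙 (inc y M) * h y ≡ 0
    off y y≢z with inc y M in y-on-M | inc y L in y-on-L
    ... | true  | true  = ⊥-elim (y≢z (same-point M≢L y-on-M y-on-L (on-point₁ M≢L) (on-point₂ M≢L)))
    ... | true  | false = trans (*-identityˡ _) (h-supp y y-on-L)
    ... | false | _     = refl
    on : 𝟙 (inc (point M L M≢L) M) * h (point M L M≢L) ≡ h (point M L M≢L)
    on rewrite on-point₁ M≢L = *-identityˡ _

  ∑-meet : ∀ {L M} → M ≢ L → ∑[ x < p ] (𝟙 (inc x M) * 𝟙 (inc x L)) ≡ 1
  ∑-meet {L} M≢L = trans (∑-supported M≢L (λ x → 𝟙 (inc x L)) supp) (cong 𝟙 (on-point₂ M≢L))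
    where
    supp : ∀ x → x off L → 𝟙 (inc x L) ≡ 0
    supp x x-off = cong 𝟙 x-off

module Induced {p l : ℕ} (Π : ProjectivePlane p l) where
  open ProjectivePlane Π
  open Incidence Π

  induced : (Fin l → ℕ) → Fin p → ℕ
  induced a x = ∑[ M < l ] (𝟙 (inc x M) * a M)

  induced-+ : ∀ (a b : Fin l → ℕ) x → induced (λ M → a M + b M) x ≡ induced a x + induced b x
  induced-+ a b x =
    trans (sum-cong-≗ λ M → *-distribˡ-+ (𝟙 (inc x M)) (a M) (b M))
          (∑-distrib-+ (λ M → 𝟙 (inc x M) * a M) (λ M → 𝟙 (inc x M) * b M))

  induced-δ : ∀ L w x → induced (λ M → 𝟙 ⌊ M ≟ L ⌋ * w) x ≡ 𝟙 (inc x L) * w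
  induced-δ L w x = trans (sum-cong-≗ λ M → swap (𝟙 (inc x M)) (𝟙 ⌊ M ≟ L ⌋) w)
                          (∑-δ (λ M → 𝟙 (inc x M) * w) L)
    where
    swap : ∀ a b c → a * (b * c) ≡ b * (a * c)
    swap = solve-∀

  module _ (n : ℕ) (order : HasOrder Π n) where

    ∑-on : ∀ L → ∑[ x < p ] 𝟙 (inc x L) ≡ ℕ.suc n
    ∑-on L = trans (sym (sumFin≡∑ p _)) (order L)

    ∑-on-both : ∀ L M → ∑[ x < p ] (𝟙 (inc x L) * 𝟙 (inc x M)) ≡ ℕ.suc (𝟙 ⌊ M ≟ L ⌋ * n)
    ∑-on-both L M with M ≟ L
    ... | yes refl = trans (sum-cong-≗ λ x → 𝟙-square (inc x L))
                           (trans (∑-on L) (cong ℕ.suc (sym (+-identityʳ n))))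
    ... | no M≢L   = ∑-meet (M≢L ∘ sym)

    -- The line sums of an induced labelling: every line M is counted once
    -- for each of its points on L, that is once, or n + 1 times if M = L.
    induced-line-sum : ∀ a L → ∑[ x < p ] (𝟙 (inc x L) * induced a x) ≡ sum a + n * a L
    induced-line-sum a L = begin
      ∑[ x < p ] (𝟙 (inc x L) * induced a x)
        ≡⟨ sum-cong-≗ (λ x → *-distribˡ-sum (𝟙 (inc x L)) (λ M → 𝟙 (inc x M) * a M)) ⟩
      ∑[ x < p ] ∑[ M < l ] (𝟙 (inc x L) * (𝟙 (inc x M) * a M))
        ≡⟨ ∑-comm (λ x M → 𝟙 (inc x L) * (𝟙 (inc x M) * a M)) ⟩
      ∑[ M < l ] ∑[ x < p ] (𝟙 (inc x L) * (𝟙 (inc x M) * a M))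
        ≡⟨ sum-cong-≗ (λ M → trans (sum-cong-≗ λ x → pull-out (𝟙 (inc x L)) (𝟙 (inc x M)) (a M))
                                   (sym (*-distribˡ-sum (a M) (λ x → 𝟙 (inc x L) * 𝟙 (inc x M))))) ⟩
      ∑[ M < l ] (a M * ∑[ x < p ] (𝟙 (inc x L) * 𝟙 (inc x M)))
        ≡⟨ sum-cong-≗ (λ M → cong (a M *_) (∑-on-both L M)) ⟩
      ∑[ M < l ] (a M * ℕ.suc (𝟙 ⌊ M ≟ L ⌋ * n))
        ≡⟨ sum-cong-≗ (λ M → spread (a M) (𝟙 ⌊ M ≟ L ⌋) n) ⟩
      ∑[ M < l ] (a M + 𝟙 ⌊ M ≟ L ⌋ * (n * a M))
        ≡⟨ ∑-distrib-+ a (λ M → 𝟙 ⌊ M ≟ L ⌋ * (n * a M)) ⟩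
      sum a + ∑[ M < l ] (𝟙 ⌊ M ≟ L ⌋ * (n * a M))
        ≡⟨ cong (sum a +_) (∑-δ (λ M → n * a M) L) ⟩
      sum a + n * a L ∎
      where
      open ≡-Reasoning
      pull-out : ∀ b c w → b * (c * w) ≡ w * (b * c)
      pull-out = solve-∀
      spread : ∀ w d n → w * ℕ.suc (d * n) ≡ w + d * (n * w)
      spread = solve-∀

module InducedLabelling {p l : ℕ} (Π : ProjectivePlane p l) (n : ℕ) .{{_ : NonZero n}}
                        (order : HasOrder Π n) (a₁ a₂ a₃ : Fin l → ℕ) where
  open Induced Π
  open Residues n

  label : Fin p → Zn³ n
  label x = reduce (induced a₁ x) (induced a₂ x) (induced a₃ x)

  label-lineSum : ∀ L → lineSum n Π label L ≡ reduce (sum a₁) (sum a₂) (sum a₃)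
  label-lineSum L = trans (lineSum-reduce Π (induced a₁) (induced a₂) (induced a₃) L)
                          (cong₂ _,_ (residue a₁) (cong₂ _,_ (residue a₂) (residue a₃)))
    where
    residue : ∀ a → (∑[ x < p ] (𝟙 (ProjectivePlane.inc Π x L) * induced a x)) mod n ≡ sum a mod n
    residue a = trans (cong (_mod n) (induced-line-sum n order a L)) (mod-absorb (sum a) (a L))

  label-magic : Injective _≡_ _≡_ label → MagicOverZn³ n Π
  label-magic injective = label , injective , reduce (sum a₁) (sum a₂) (sum a₃) , label-lineSum

labels : ℕ → List ℕ
labels = applyUpTo ℕ.suc

tri : ℕ → ℕ
tri ℕ.zero    = 0
tri (ℕ.suc m) = ℕ.suc m + tri m

count : ∀ {k} → (Fin k → Bool) → ℕ
count {k} T = ∑[ i < k ] 𝟙 (T i)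

rank : ∀ {k} → (Fin k → Bool) → Fin k → ℕ
rank T zero    = 0
rank T (suc i) = 𝟙 (T zero) + rank (T ∘ suc) i

enumerate : ∀ {k} → (Fin k → Bool) → Fin k → ℕ
enumerate T i = 𝟙 (T i) * ℕ.suc (rank T i)

rank-< : ∀ {k} (T : Fin k → Bool) {i} → T i ≡ true → rank T i < count T
rank-< T {zero}  Ti rewrite Ti = s≤s z≤n
rank-< T {suc i} Ti = +-monoʳ-< (𝟙 (T zero)) (rank-< (T ∘ suc) Ti)

rank-injective : ∀ {k} (T : Fin k → Bool) {i j} → T i ≡ true → T j ≡ true → rank T i ≡ rank T j → i ≡ j
rank-injective T {zero}  {zero}  Ti Tj eq = refl
rank-injective T {zero}  {suc j} Ti Tj eq rewrite Ti = ⊥-elim (0≢1+n eq)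
rank-injective T {suc i} {zero}  Ti Tj eq rewrite Tj = ⊥-elim (1+n≢0 eq)
rank-injective T {suc i} {suc j} Ti Tj eq =
  cong suc (rank-injective (T ∘ suc) Ti Tj (+-cancelˡ-≡ (𝟙 (T zero)) _ _ eq))

enumerate-selected : ∀ {k} (T : Fin k → Bool) {i} → T i ≡ true → enumerate T i ≡ ℕ.suc (rank T i)
enumerate-selected T Ti rewrite Ti = +-identityʳ _

enumerate-unselected : ∀ {k} (T : Fin k → Bool) {i} → T i ≡ false → enumerate T i ≡ 0
enumerate-unselected T Ti rewrite Ti = refl

enumerate-injective : ∀ {k} (T : Fin k → Bool) {i j} → T i ≡ true →
                      enumerate T i ≡ enumerate T j → i ≡ j
enumerate-injective T {i} {j} Ti eq = by-cases (T j) refl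
  where
  by-cases : ∀ b → T j ≡ b → i ≡ j
  by-cases true  Tj = rank-injective T Ti Tj (ℕ-suc-injective
    (trans (sym (enumerate-selected T Ti)) (trans eq (enumerate-selected T Tj))))
  by-cases false Tj = ⊥-elim (1+n≢0
    (trans (sym (enumerate-selected T Ti)) (trans eq (enumerate-unselected T Tj))))

enumerate-label : ∀ {k} (T : Fin k → Bool) {i} → T i ≡ true → enumerate T i ∈ labels (count T)
enumerate-label T Ti = subst (_∈ labels (count T)) (sym (enumerate-selected T Ti))
                             (∈-applyUpTo⁺ ℕ.suc (rank-< T Ti))

∑-enumerate : ∀ {k} (T : Fin k → Bool) → ∑[ i < k ] enumerate T i ≡ tri (count T)
∑-enumerate {ℕ.zero}  T = refl
∑-enumerate {ℕ.suc k} T with T zero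
... | true  = cong ℕ.suc (trans (sum-cong-≗ λ i → *-suc (𝟙 (T (suc i))) _)
                (trans (∑-distrib-+ (λ i → 𝟙 (T (suc i))) (enumerate (T ∘ suc)))
                       (cong (count (T ∘ suc) +_) (∑-enumerate (T ∘ suc)))))
... | false = ∑-enumerate (T ∘ suc)

module Cone {p l : ℕ} (Π : ProjectivePlane p l) (A : Fin p) (base : Fin l)
            (A-off : Incidence._off_ Π A base)
            (h : Fin p → ℕ) (h-supp : ∀ y → Incidence._off_ Π y base → h y ≡ 0) where
  open ProjectivePlane Π
  open Incidence Π
  open Induced Π

  cone : Fin l → ℕ
  cone M = 𝟙 (inc A M) * ∑[ y < p ] (𝟙 (inc y M) * h y)

  axis-≢-base : ∀ {x} (x≢A : x ≢ A) → line x A x≢A ≢ base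
  axis-≢-base x≢A = on-off⇒≢ (on-line₂ x≢A) A-off

  foot : (x : Fin p) → x ≢ A → Fin p
  foot x x≢A = point (line x A x≢A) base (axis-≢-base x≢A)

  foot-on-axis : ∀ {x} (x≢A : x ≢ A) → foot x x≢A on line x A x≢A
  foot-on-axis x≢A = on-point₁ (axis-≢-base x≢A)

  foot-on-base : ∀ {x} (x≢A : x ≢ A) → foot x x≢A on base
  foot-on-base x≢A = on-point₂ (axis-≢-base x≢A)

  foot-of-base : ∀ {x} (x≢A : x ≢ A) → x on base → foot x x≢A ≡ x
  foot-of-base x≢A x-on =
    same-point (axis-≢-base x≢A) (foot-on-axis x≢A) (foot-on-base x≢A) (on-line₁ x≢A) x-on

  induced-cone : ∀ {x} (x≢A : x ≢ A) → induced cone x ≡ h (foot x x≢A)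
  induced-cone x≢A = trans (∑-through x≢A (λ M → ∑[ y < p ] (𝟙 (inc y M) * h y)))
                           (∑-supported (axis-≢-base x≢A) h h-supp)

  induced-cone-apex : induced cone A ≡ ∑[ y < p ] h y
  induced-cone-apex = begin
    ∑[ M < l ] (𝟙 (inc A M) * (𝟙 (inc A M) * weight M))
      ≡⟨ sum-cong-≗ (λ M → 𝟙-idem (inc A M) (weight M)) ⟩
    ∑[ M < l ] (𝟙 (inc A M) * weight M)
      ≡⟨ sum-cong-≗ (λ M → *-distribˡ-sum (𝟙 (inc A M)) (λ y → 𝟙 (inc y M) * h y)) ⟩
    ∑[ M < l ] ∑[ y < p ] (𝟙 (inc A M) * (𝟙 (inc y M) * h y))
      ≡⟨ ∑-comm (λ M y → 𝟙 (inc A M) * (𝟙 (inc y M) * h y)) ⟩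
    ∑[ y < p ] ∑[ M < l ] (𝟙 (inc A M) * (𝟙 (inc y M) * h y))
      ≡⟨ sum-cong-≗ one-line ⟩
    ∑[ y < p ] h y ∎
    where
    open ≡-Reasoning
    weight : Fin l → ℕ
    weight M = ∑[ y < p ] (𝟙 (inc y M) * h y)
    -- a point y ≠ A lies on exactly one line through A, and h vanishes at A
    one-line : ∀ y → ∑[ M < l ] (𝟙 (inc A M) * (𝟙 (inc y M) * h y)) ≡ h y
    one-line y with y ≟ A
    ... | no y≢A    = ∑-through (y≢A ∘ sym) (λ _ → h y)
    ... | yes refl rewrite h-supp A A-off =
      ∑-zero λ M → trans (cong (𝟙 (inc A M) *_) (*-zeroʳ (𝟙 (inc A M)))) (*-zeroʳ (𝟙 (inc A M)))

module Triangles {p l : ℕ} (Π : ProjectivePlane p l) where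
  open ProjectivePlane Π
  open Incidence Π

  record Triangle : Set where
    field
      A B C    : Fin p
      AB BC CA : Fin l
      A-on-AB  : A on AB
      B-on-AB  : B on AB
      B-on-BC  : B on BC
      C-on-BC  : C on BC
      C-on-CA  : C on CA
      A-on-CA  : A on CA
      A-off-BC : A off BC
      B-off-CA : B off CA
      C-off-AB : C off AB

  rotate : Triangle → Triangle
  rotate t = record
    { A = B ; B = C ; C = A ; AB = BC ; BC = CA ; CA = AB
    ; A-on-AB = B-on-BC ; B-on-AB = C-on-BC ; B-on-BC = C-on-CA ; C-on-BC = A-on-CA
    ; C-on-CA = A-on-AB ; A-on-CA = B-on-AB
    ; A-off-BC = B-off-CA ; B-off-CA = C-off-AB ; C-off-AB = A-off-BC }
    where open Triangle t

  triangle : Triangle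
  triangle with quadrangle
  ... | a , b , c , _ , (a≢b , a≢c , _ , b≢c , _ , _) , abc-not-collinear , _ = record
    { A = a ; B = b ; C = c
    ; AB = line a b a≢b ; BC = line b c b≢c ; CA = line c a c≢a
    ; A-on-AB = on-line₁ a≢b ; B-on-AB = on-line₂ a≢b
    ; B-on-BC = on-line₁ b≢c ; C-on-BC = on-line₂ b≢c
    ; C-on-CA = on-line₁ c≢a ; A-on-CA = on-line₂ c≢a
    ; A-off-BC = ¬-not λ a-on → abc-not-collinear _ (a-on , on-line₁ b≢c , on-line₂ b≢c)
    ; B-off-CA = ¬-not λ b-on → abc-not-collinear _ (on-line₂ c≢a , b-on , on-line₁ c≢a)
    ; C-off-AB = ¬-not λ c-on → abc-not-collinear _ (on-line₁ a≢b , on-line₂ a≢b , c-on) }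
    where
    c≢a : c ≢ a
    c≢a = a≢c ∘ sym

module TriangleLabelling {p l : ℕ} (Π : ProjectivePlane p l) (n : ℕ) (order : HasOrder Π n)
                         (t : Triangles.Triangle Π) where
  open ProjectivePlane Π
  open Incidence Π
  open Induced Π
  open Triangles.Triangle t

  inner : Fin p → Bool
  inner y = inc y BC ∧ not (inc y AB) ∧ not (inc y CA)

  inner-intro : ∀ {y} → y on BC → y off AB → y off CA → inner y ≡ true
  inner-intro y-BC y-AB y-CA rewrite y-BC | y-AB | y-CA = refl

  inner-off-AB : ∀ {y} → y on AB → inner y ≡ false
  inner-off-AB {y} y-AB rewrite y-AB = ∧-zeroʳ (inc y BC)

  inner-off-CA : ∀ {y} → y on CA → inner y ≡ false
  inner-off-CA {y} y-CA rewrite y-CA =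
    trans (cong (inc y BC ∧_) (∧-zeroʳ (not (inc y AB)))) (∧-zeroʳ (inc y BC))

  mark : Fin p → ℕ
  mark = enumerate inner

  mark-supported : ∀ y → y off BC → mark y ≡ 0
  mark-supported y y-BC rewrite y-BC = refl

  open Cone Π A BC A-off-BC mark mark-supported public using (cone)
  open Cone Π A BC A-off-BC mark mark-supported
    using (foot; foot-on-axis; foot-on-base; foot-of-base; induced-cone; induced-cone-apex)

  E : Fin p → ℕ
  E = induced cone

  on-BC⇒≢A : ∀ {x} → x on BC → x ≢ A
  on-BC⇒≢A x-BC x≡A = off⇒≢ A-off-BC x-BC (sym x≡A)

  AB≢CA : AB ≢ CA
  AB≢CA = on-off⇒≢ B-on-AB B-off-CA

  at-A : ∀ {x} → x on AB → x on CA → x ≡ A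
  at-A x-AB x-CA = same-point AB≢CA x-AB x-CA A-on-AB A-on-CA

  -- Side BC has n + 1 points: B, C and the inner ones.
  count-inner : ℕ.suc (count inner) ≡ n
  count-inner = ℕ-suc-injective (begin
    2 + count inner
      ≡⟨ +-comm 2 (count inner) ⟩
    count inner + (1 + 1)
      ≡⟨ cong (count inner +_) (sym (cong₂ _+_ (∑-meet BC≢AB) (∑-meet BC≢CA))) ⟩
    count inner + (∑[ y < p ] on-AB y + ∑[ y < p ] on-CA y)
      ≡⟨ cong (count inner +_) (sym (∑-distrib-+ on-AB on-CA)) ⟩
    count inner + ∑[ y < p ] (on-AB y + on-CA y)
      ≡⟨ sym (∑-distrib-+ (𝟙 ∘ inner) (λ y → on-AB y + on-CA y)) ⟩
    ∑[ y < p ] (𝟙 (inner y) + (on-AB y + on-CA y))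
      ≡⟨ sum-cong-≗ (λ y → sym (𝟙-split (inc y AB) (inc y CA) (inc y BC) (at-A-off-BC y))) ⟩
    ∑[ y < p ] 𝟙 (inc y BC)
      ≡⟨ ∑-on n order BC ⟩
    ℕ.suc n ∎)
    where
    open ≡-Reasoning
    on-AB on-CA : Fin p → ℕ
    on-AB y = 𝟙 (inc y BC) * 𝟙 (inc y AB)
    on-CA y = 𝟙 (inc y BC) * 𝟙 (inc y CA)
    BC≢AB : BC ≢ AB
    BC≢AB = on-off⇒≢ A-on-AB A-off-BC ∘ sym
    BC≢CA : BC ≢ CA
    BC≢CA = on-off⇒≢ A-on-CA A-off-BC ∘ sym
    at-A-off-BC : ∀ y → y on AB → y on CA → y off BC
    at-A-off-BC y y-AB y-CA = subst (_off BC) (sym (at-A y-AB y-CA)) A-off-BC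

  inner-label : ∀ {y} → inner y ≡ true → mark y ∈ labels (pred n)
  inner-label {y} inner-y =
    subst (λ m → mark y ∈ labels m) (cong pred count-inner) (enumerate-label inner inner-y)

  E-apex : E A ≡ tri (pred n)
  E-apex = trans induced-cone-apex
                 (trans (∑-enumerate inner) (cong tri (cong pred count-inner)))

  E-vertex : ∀ {x} → x on AB → x on CA → E x ≡ tri (pred n)
  E-vertex x-AB x-CA = trans (cong E (at-A x-AB x-CA)) E-apex

  -- A point x ≠ A of AB (or of CA) has foot B (or C), which is not inner.
  E-on-AB : ∀ {x} → x on AB → x off CA → E x ≡ 0
  E-on-AB {x} x-AB x-CA = trans (induced-cone x≢A) (enumerate-unselected inner (inner-off-AB foot-AB))
    where
    x≢A = off⇒≢ x-CA A-on-CA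
    foot-AB = subst (foot x x≢A on_) (line-unique x≢A x-AB A-on-AB) (foot-on-axis x≢A)

  E-on-CA : ∀ {x} → x on CA → x off AB → E x ≡ 0
  E-on-CA {x} x-CA x-AB = trans (induced-cone x≢A) (enumerate-unselected inner (inner-off-CA foot-CA))
    where
    x≢A = off⇒≢ x-AB A-on-AB
    foot-CA = subst (foot x x≢A on_) (line-unique x≢A x-CA A-on-CA) (foot-on-axis x≢A)

  -- An inner point is its own foot, so it is labelled by its number;
  -- inner points with the same label coincide.
  E-inner : ∀ {x} → x on BC → E x ≡ mark x
  E-inner x-BC = trans (induced-cone x≢A) (cong mark (foot-of-base x≢A x-BC))
    where x≢A = on-BC⇒≢A x-BC

  E-inner-label : ∀ {x} → x on BC → x off AB → x off CA → E x ∈ labels (pred n)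
  E-inner-label x-BC x-AB x-CA =
    subst (_∈ labels (pred n)) (sym (E-inner x-BC)) (inner-label (inner-intro x-BC x-AB x-CA))

  inner-unique : ∀ {x y} → x on BC → x off AB → x off CA → y on BC → E x ≡ E y → x ≡ y
  inner-unique x-BC x-AB x-CA y-BC Ex≡Ey =
    enumerate-injective inner (inner-intro x-BC x-AB x-CA)
      (trans (sym (E-inner x-BC)) (trans Ex≡Ey (E-inner y-BC)))

  module Interior {x} (x-AB : x off AB) (x-BC : x off BC) (x-CA : x off CA) where
    x≢A : x ≢ A
    x≢A = off⇒≢ x-AB A-on-AB

    f : Fin p
    f = foot x x≢A

    f≢A : f ≢ A
    f≢A = on-BC⇒≢A (foot-on-base x≢A)

    -- if the foot were on a side through A, that side would be xA
    f-off : ∀ {M} → A on M → x off M → f off M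
    f-off A-M x-M = ¬-not λ f-M → off⇒≢ x-M (through-axis x≢A f≢A (foot-on-axis x≢A) f-M A-M) refl

    f-inner : inner f ≡ true
    f-inner = inner-intro (foot-on-base x≢A) (f-off A-on-AB x-AB) (f-off A-on-CA x-CA)

    E-interior : E x ≡ mark f
    E-interior = induced-cone x≢A

  E-interior-label : ∀ {x} → x off AB → x off BC → x off CA → E x ∈ labels (pred n)
  E-interior-label x-AB x-BC x-CA =
    subst (_∈ labels (pred n)) (sym E-interior) (inner-label f-inner)
    where open Interior x-AB x-BC x-CA

  interior-axis : ∀ {x y} (x-AB : x off AB) (x-BC : x off BC) (x-CA : x off CA) →
                  y off AB → y off BC → y off CA → E x ≡ E y →
                  y on line x A (Interior.x≢A x-AB x-BC x-CA)
  interior-axis {x} {y} x-AB x-BC x-CA y-AB y-BC y-CA Ex≡Ey =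
    through-axis Y.x≢A X.f≢A (subst (_on line y A Y.x≢A) (sym fx≡fy) (foot-on-axis Y.x≢A))
                 (foot-on-axis X.x≢A) (on-line₂ X.x≢A)
    where
    module X = Interior x-AB x-BC x-CA
    module Y = Interior y-AB y-BC y-CA
    fx≡fy : X.f ≡ Y.f
    fx≡fy = enumerate-injective inner X.f-inner (trans (sym X.E-interior) (trans Ex≡Ey Y.E-interior))

-- The profile of a point with respect to a triangle: whether it lies on
-- AB, BC, CA, and its labels in the three triangle labellings.
Profile : Set
Profile = Bool × Bool × Bool × ℕ × ℕ × ℕ

_≟P_ : DecidableEquality Profile
_≟P_ = ≡-dec _≟𝔹_ (≡-dec _≟𝔹_ (≡-dec _≟𝔹_ (≡-dec _≟ℕ_ (≡-dec _≟ℕ_ _≟ℕ_))))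

profile-components : ∀ {b₁ b₂ b₃ e₁ e₂ e₃ b₁′ b₂′ b₃′ e₁′ e₂′ e₃′} →
  _≡_ {A = Profile} (b₁ , b₂ , b₃ , e₁ , e₂ , e₃) (b₁′ , b₂′ , b₃′ , e₁′ , e₂′ , e₃′) →
  b₁ ≡ b₁′ × b₂ ≡ b₂′ × b₃ ≡ b₃′ × e₁ ≡ e₁′ × e₂ ≡ e₂′ × e₃ ≡ e₃′
profile-components refl = refl , refl , refl , refl , refl , refl

sideWeight : (w₁ w₂ w₃ : ℕ) → Bool → Bool → Bool → ℕ
sideWeight w₁ w₂ w₃ b₁ b₂ b₃ = 𝟙 b₁ * w₁ + (𝟙 b₂ * w₂ + 𝟙 b₃ * w₃)

-- The side weights of the three weightings, chosen so that the check
-- below succeeds.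
side₁ side₂ side₃ : Bool → Bool → Bool → ℕ
side₁ = sideWeight 2 4 0
side₂ = sideWeight 0 2 1
side₃ = sideWeight 2 0 4

encode : (n : ℕ) .{{_ : NonZero n}} → Profile → Zn³ n
encode n (b₁ , b₂ , b₃ , e₁ , e₂ , e₃) =
  reduce (e₁ + side₁ b₁ b₂ b₃) (e₂ + side₂ b₁ b₂ b₃) (e₃ + side₃ b₁ b₂ b₃)
  where open Residues n

inner₁ inner₂ inner₃ : ℕ → Profile
inner₁ e = false , true , false , e , 0 , 0
inner₂ e = false , false , true , 0 , e , 0
inner₃ e = true , false , false , 0 , 0 , e

interior : ℕ × ℕ × ℕ → Profile
interior (e₁ , e₂ , e₃) = false , false , false , e₁ , e₂ , e₃

profiles : ℕ → List Profile
profiles n =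
  (true , false , true , t , 0 , 0) ∷ (true , true , false , 0 , t , 0) ∷
  (false , true , true , 0 , 0 , t) ∷
  map inner₁ ls ++ map inner₂ ls ++ map inner₃ ls ++
  map interior (cartesianProduct ls (cartesianProduct ls ls))
  where
  t  = tri (pred n)
  ls = labels (pred n)

module ProfileMembership (n : ℕ) where
  private
    ls = labels (pred n)
    t  = tri (pred n)

  ∈-vertex₁ : ∀ {e₁ e₂ e₃} → e₁ ≡ t → e₂ ≡ 0 → e₃ ≡ 0 → (true , false , true , e₁ , e₂ , e₃) ∈ profiles n
  ∈-vertex₁ refl refl refl = here refl

  ∈-vertex₂ : ∀ {e₁ e₂ e₃} → e₁ ≡ 0 → e₂ ≡ t → e₃ ≡ 0 → (true , true , false , e₁ , e₂ , e₃) ∈ profiles n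
  ∈-vertex₂ refl refl refl = there (here refl)

  ∈-vertex₃ : ∀ {e₁ e₂ e₃} → e₁ ≡ 0 → e₂ ≡ 0 → e₃ ≡ t → (false , true , true , e₁ , e₂ , e₃) ∈ profiles n
  ∈-vertex₃ refl refl refl = there (there (here refl))

  ∈-side₁ : ∀ {e₁ e₂ e₃} → e₁ ∈ ls → e₂ ≡ 0 → e₃ ≡ 0 → (false , true , false , e₁ , e₂ , e₃) ∈ profiles n
  ∈-side₁ e₁∈ refl refl = there (there (there (∈-++⁺ˡ (∈-map⁺ inner₁ e₁∈))))

  ∈-side₂ : ∀ {e₁ e₂ e₃} → e₁ ≡ 0 → e₂ ∈ ls → e₃ ≡ 0 → (false , false , true , e₁ , e₂ , e₃) ∈ profiles n
  ∈-side₂ refl e₂∈ refl = there (there (there (∈-++⁺ʳ (map inner₁ ls) (∈-++⁺ˡ (∈-map⁺ inner₂ e₂∈)))))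

  ∈-side₃ : ∀ {e₁ e₂ e₃} → e₁ ≡ 0 → e₂ ≡ 0 → e₃ ∈ ls → (true , false , false , e₁ , e₂ , e₃) ∈ profiles n
  ∈-side₃ refl refl e₃∈ =
    there (there (there (∈-++⁺ʳ (map inner₁ ls) (∈-++⁺ʳ (map inner₂ ls) (∈-++⁺ˡ (∈-map⁺ inner₃ e₃∈))))))

  ∈-interior : ∀ {e₁ e₂ e₃} → e₁ ∈ ls → e₂ ∈ ls → e₃ ∈ ls →
               (false , false , false , e₁ , e₂ , e₃) ∈ profiles n
  ∈-interior e₁∈ e₂∈ e₃∈ =
    there (there (there (∈-++⁺ʳ (map inner₁ ls) (∈-++⁺ʳ (map inner₂ ls) (∈-++⁺ʳ (map inner₃ ls)
      (∈-map⁺ interior (∈-cartesianProduct⁺ e₁∈ (∈-cartesianProduct⁺ e₂∈ e₃∈))))))))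

module _ (n : ℕ) .{{_ : NonZero n}} where

  Separated : Set
  Separated = All (λ π → All (λ π′ → encode n π ≡ encode n π′ → π ≡ π′) (profiles n)) (profiles n)

  separated? : Dec Separated
  separated? = all? (λ π → all? (λ π′ → (encode n π ≟G encode n π′) →-dec (π ≟P π′))
                                (profiles n))
                    (profiles n)
    where
    _≟G_ : DecidableEquality (Zn³ n)
    _≟G_ = ≡-dec _≟_ (≡-dec _≟_ _≟_)

  encode-injective : Separated → ∀ {π π′} → π ∈ profiles n → π′ ∈ profiles n →
                     encode n π ≡ encode n π′ → π ≡ π′
  encode-injective sep π∈ π′∈ = lookup (lookup sep π∈) π′∈

separated₂ : Separated 2
separated₂ = toWitness {a? = separated? 2} _

separated₃ : Separated 3
separated₃ = toWitness {a? = separated? 3} _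

separated₄ : Separated 4
separated₄ = toWitness {a? = separated? 4} _

module Construction {p l : ℕ} (Π : ProjectivePlane p l) (n : ℕ) .{{_ : NonZero n}}
                    (order : HasOrder Π n) where
  open ProjectivePlane Π
  open Incidence Π
  open Induced Π
  open Triangles Π
  open Triangle triangle
  open ProfileMembership n

  module E₁ = TriangleLabelling Π n order triangle
  module E₂ = TriangleLabelling Π n order (rotate triangle)
  module E₃ = TriangleLabelling Π n order (rotate (rotate triangle))

  induced-sides : ∀ w₁ w₂ w₃ x →
    induced (λ M → sideWeight w₁ w₂ w₃ ⌊ M ≟ AB ⌋ ⌊ M ≟ BC ⌋ ⌊ M ≟ CA ⌋) x ≡
    sideWeight w₁ w₂ w₃ (inc x AB) (inc x BC) (inc x CA)
  induced-sides w₁ w₂ w₃ x =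
    trans (induced-+ (λ M → 𝟙 ⌊ M ≟ AB ⌋ * w₁) _ x)
          (cong₂ _+_ (induced-δ AB w₁ x)
                     (trans (induced-+ (λ M → 𝟙 ⌊ M ≟ BC ⌋ * w₂) _ x)
                            (cong₂ _+_ (induced-δ BC w₂ x) (induced-δ CA w₃ x))))

  weighting : (Fin l → ℕ) → (Bool → Bool → Bool → ℕ) → Fin l → ℕ
  weighting cone side M = cone M + side ⌊ M ≟ AB ⌋ ⌊ M ≟ BC ⌋ ⌊ M ≟ CA ⌋

  open InducedLabelling Π n order (weighting E₁.cone side₁) (weighting E₂.cone side₂)
                                  (weighting E₃.cone side₃)

  profile : Fin p → Profile
  profile x = inc x AB , inc x BC , inc x CA , E₁.E x , E₂.E x , E₃.E x

  label-profile : ∀ x → label x ≡ encode n (profile x)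
  label-profile x = reduce-cong (split E₁.cone 2 4 0) (split E₂.cone 0 2 1) (split E₃.cone 2 0 4)
    where
    open Residues n
    split : ∀ cone w₁ w₂ w₃ → induced (weighting cone (sideWeight w₁ w₂ w₃)) x ≡
                              induced cone x + sideWeight w₁ w₂ w₃ (inc x AB) (inc x BC) (inc x CA)
    split cone w₁ w₂ w₃ =
      trans (induced-+ cone _ x) (cong (induced cone x +_) (induced-sides w₁ w₂ w₃ x))

  profile-∈ : ∀ x → profile x ∈ profiles n
  profile-∈ x = classify (inc x AB) (inc x BC) (inc x CA) refl refl refl
    where
    classify : ∀ b₁ b₂ b₃ → inc x AB ≡ b₁ → inc x BC ≡ b₂ → inc x CA ≡ b₃ →
               (b₁ , b₂ , b₃ , E₁.E x , E₂.E x , E₃.E x) ∈ profiles n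
    classify true  true  true  x-AB x-BC x-CA = ⊥-elim (E₁.on-BC⇒≢A x-BC (E₁.at-A x-AB x-CA))
    classify true  false true  x-AB x-BC x-CA =
      ∈-vertex₁ (E₁.E-vertex x-AB x-CA) (E₂.E-on-CA x-AB x-BC) (E₃.E-on-AB x-CA x-BC)
    classify true  true  false x-AB x-BC x-CA =
      ∈-vertex₂ (E₁.E-on-AB x-AB x-CA) (E₂.E-vertex x-BC x-AB) (E₃.E-on-CA x-BC x-CA)
    classify false true  true  x-AB x-BC x-CA =
      ∈-vertex₃ (E₁.E-on-CA x-CA x-AB) (E₂.E-on-AB x-BC x-AB) (E₃.E-vertex x-CA x-BC)
    classify false true  false x-AB x-BC x-CA =
      ∈-side₁ (E₁.E-inner-label x-BC x-AB x-CA) (E₂.E-on-AB x-BC x-AB) (E₃.E-on-CA x-BC x-CA)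
    classify false false true  x-AB x-BC x-CA =
      ∈-side₂ (E₁.E-on-CA x-CA x-AB) (E₂.E-inner-label x-CA x-BC x-AB) (E₃.E-on-AB x-CA x-BC)
    classify true  false false x-AB x-BC x-CA =
      ∈-side₃ (E₁.E-on-AB x-AB x-CA) (E₂.E-on-CA x-AB x-BC) (E₃.E-inner-label x-AB x-CA x-BC)
    classify false false false x-AB x-BC x-CA =
      ∈-interior (E₁.E-interior-label x-AB x-BC x-CA) (E₂.E-interior-label x-BC x-CA x-AB)
                 (E₃.E-interior-label x-CA x-AB x-BC)

  -- Points with the same profile share two distinct lines, hence coincide.
  profile-injective : ∀ {x y} → profile x ≡ profile y → x ≡ y
  profile-injective {x} {y} eq with profile-components eq
  ... | AB≡ , BC≡ , CA≡ , E₁≡ , E₂≡ , E₃≡ =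
    compare (inc x AB) (inc x BC) (inc x CA) refl refl refl (sym AB≡) (sym BC≡) (sym CA≡)
    where
    compare : ∀ b₁ b₂ b₃ → inc x AB ≡ b₁ → inc x BC ≡ b₂ → inc x CA ≡ b₃ →
                           inc y AB ≡ b₁ → inc y BC ≡ b₂ → inc y CA ≡ b₃ → x ≡ y
    compare true  true  true  x-AB x-BC x-CA _ _ _ = ⊥-elim (E₁.on-BC⇒≢A x-BC (E₁.at-A x-AB x-CA))
    compare true  false true  x-AB x-BC x-CA y-AB y-BC y-CA =
      trans (E₁.at-A x-AB x-CA) (sym (E₁.at-A y-AB y-CA))
    compare true  true  false x-AB x-BC x-CA y-AB y-BC y-CA =
      trans (E₂.at-A x-BC x-AB) (sym (E₂.at-A y-BC y-AB))
    compare false true  true  x-AB x-BC x-CA y-AB y-BC y-CA =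
      trans (E₃.at-A x-CA x-BC) (sym (E₃.at-A y-CA y-BC))
    compare false true  false x-AB x-BC x-CA y-AB y-BC y-CA = E₁.inner-unique x-BC x-AB x-CA y-BC E₁≡
    compare false false true  x-AB x-BC x-CA y-AB y-BC y-CA = E₂.inner-unique x-CA x-BC x-AB y-CA E₂≡
    compare true  false false x-AB x-BC x-CA y-AB y-BC y-CA = E₃.inner-unique x-AB x-CA x-BC y-AB E₃≡
    compare false false false x-AB x-BC x-CA y-AB y-BC y-CA =
      same-point (lines-≢ x≢A x≢B A≢B A-on-AB B-on-AB x-AB) (on-line₁ x≢A) (on-line₁ x≢B)
        (E₁.interior-axis x-AB x-BC x-CA y-AB y-BC y-CA E₁≡)
        (E₂.interior-axis x-BC x-CA x-AB y-BC y-CA y-AB E₂≡)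
      where
      x≢A = E₁.Interior.x≢A x-AB x-BC x-CA
      x≢B = E₂.Interior.x≢A x-BC x-CA x-AB
      A≢B = off⇒≢ A-off-BC B-on-BC

  magic : Separated n → MagicOverZn³ n Π
  magic separated = label-magic λ {x} {y} label-x≡label-y →
    profile-injective (encode-injective n separated (profile-∈ x) (profile-∈ y)
      (trans (sym (label-profile x)) (trans label-x≡label-y (label-profile y))))

lemma7 : (n : ℕ) .{{_ : NonZero n}} → (n ≡ 2 ⊎ n ≡ 3 ⊎ n ≡ 4) →
         (p l : ℕ) (Π : ProjectivePlane p l) → HasOrder Π n →
         MagicOverZn³ n Π
lemma7 .2 (inj₁ refl)        p l Π order = Construction.magic Π 2 order separated₂
lemma7 .3 (inj₂ (inj₁ refl)) p l Π order = Construction.magic Π 3 order separated₃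
lemma7 .4 (inj₂ (inj₂ refl)) p l Π order = Construction.magic Π 4 order separated₄
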